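{- Let $a$ be a rational number with $v_3(a)=0$, and let $\mathcal{R}_a=\{(0,1/2),(0,-1/2),(a,1/2),(a,-1/2)\}$. If $(x,z/2)\in\mathbb{R}^2$ has rational Euclidean distance to each of the four points of $\mathcal{R}_a$ (so $x,z\in\mathbb{Q}$), then $v_3(x)\neq v_3(z)$.
   Context: For a prime $p$ and a nonzero rational $t=p^k r/s$ with $r,s$ integers coprime to $p$, $v_p(t)=k$; and $v_p(0)=\infty$. -}

module Defs where

open import Data.Nat as ℕ using (ℕ; suc; _^_)
open import Data.Nat.Divisibility using (_∣_)
open import Data.Integer as ℤ using (ℤ; +_; -[1+_]; ∣_∣)
open import Data.Rational using (ℚ; _/_; _*_; _+_; _-_; _≤_; 0ℚ; ½)
open import Data.Product using (Σ; ∃; _×_)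
open import Data.Sum using (_⊎_)
open import Relation.Nullary using (¬_)
open import Relation.Binary.PropositionalEquality using (_≡_)

ι : ℤ → ℚ
ι r = r / 1

-- HasVal p t k  :⇔  t = p^k · r / s  with r, s integers coprime to p (p prime),
-- i.e. v_p(t) = k.  (s is taken positive w.l.o.g.; s ≠ 0 and r ≠ 0 follow from p ∤ s, p ∤ r.)
-- Stated multiplied out to avoid division:  k = n ≥ 0 :  t·s = p^n·r ;
--                                           k = -(n+1) : t·s·p^(n+1) = r.
PowTimes : ℕ → ℤ → ℚ → ℕ → ℤ → Set
PowTimes p (+ n)     t s r = t * ι (+ s) ≡ ι (+ (p ^ n) ℤ.* r)
PowTimes p -[1+ n ]  t s r = t * ι (+ (s ℕ.* p ^ suc n)) ≡ ι r

HasVal : ℕ → ℚ → ℤ → Set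
HasVal p t k = Σ ℤ λ r → Σ ℕ λ s → ¬ (p ∣ ∣ r ∣) × ¬ (p ∣ s) × PowTimes p k t s r

-- v_p(t) = v_p(u), with the convention v_p(0) = ∞.
SameVal : ℕ → ℚ → ℚ → Set
SameVal p t u = (t ≡ 0ℚ × u ≡ 0ℚ) ⊎ (∃ λ k → HasVal p t k × HasVal p u k)

RationalDist : ℚ → ℚ → ℚ → ℚ → Set
RationalDist x₁ y₁ x₂ y₂ =
  ∃ λ d → (0ℚ ≤ d) × (d * d ≡ (x₁ - x₂) * (x₁ - x₂) + (y₁ - y₂) * (y₁ - y₂))

-½ : ℚ
-½ = ℤ.- (+ 1) / 2

-- Reduce modulo 3.  If two points of ℚ² with 3-integral coordinates differ
-- modulo 3 in both coordinates, their squared distance is ≡ 1 + 1 = 2, which is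
-- not a square modulo 3, so their distance is irrational.  When
-- v₃(x) = v₃(z) > 0 (or x = z = 0) this applies to (x, z/2) and (a, 1/2); when
-- v₃(x) = v₃(z) = 0 it applies to (x, z/2) and whichever of (0, ±1/2) has
-- second coordinate ≢ z/2; when v₃(x) = v₃(z) = v < 0 it applies to (0, 1/2)
-- and (x, z/2) after scaling the plane by 3^(-v).
module Submission where

open import Defs
open import Data.Integer using (+_)
open import Data.Rational using (ℚ; _*_; 0ℚ; ½)
open import Relation.Nullary using (¬_)

open import Data.Nat as ℕ using (ℕ; zero; suc; _^_)
open import Data.Nat.Divisibility using (_∣_; divides; ∣-refl; ∣m∣n⇒∣m+n)
import Data.Nat.Properties as ℕP
open import Data.Integer as ℤ using (ℤ; -[1+_]; ∣_∣; sign; -1ℤ)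
import Data.Integer.Properties as ℤP
open import Data.Sign as Sign using (Sign)
open import Data.Rational using (mkℚ; _+_; _-_; -_; ↥_; ↧ₙ_; toℚᵘ)
open import Data.Rational.Properties
  using (toℚᵘ-homo-+; toℚᵘ-homo-*; toℚᵘ-homo‿-; toℚᵘ-fromℚᵘ; toℚᵘ-injective; toℚᵘ-cong; *-identityʳ)
import Data.Rational.Unnormalised as ℚᵘ
import Data.Rational.Unnormalised.Properties as ℚᵘP
open import Data.Rational.Solver using (module +-*-Solver)
open +-*-Solver using (solve; _:+_; _:*_; _:-_; :-_; _:=_)
open import Data.Product using (Σ; _×_; _,_)
open import Data.Sum using (_⊎_; inj₁; inj₂; [_,_]′)
open import Data.Empty using (⊥)
import Data.Empty.Irrelevant as Irrelevant
open import Function using (_∘_)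
open import Relation.Nullary using (Dec; yes; no)
open import Relation.Nullary.Decidable using (True; toWitness; _→-dec_; _⊎-dec_)
open import Relation.Binary.PropositionalEquality
open ≡-Reasoning

data 𝔽₃ : Set where
  0# 1# 2# : 𝔽₃

infix  8 ⊖_
infixl 7 _⊗_
infixl 6 _⊕_ _⊖_

⊖_ : 𝔽₃ → 𝔽₃
⊖ 0# = 0#
⊖ 1# = 2#
⊖ 2# = 1#

_⊕_ : 𝔽₃ → 𝔽₃ → 𝔽₃
0# ⊕ b  = b
1# ⊕ 0# = 1#
1# ⊕ 1# = 2#
1# ⊕ 2# = 0#
2# ⊕ 0# = 2#
2# ⊕ 1# = 0#
2# ⊕ 2# = 1#

_⊗_ : 𝔽₃ → 𝔽₃ → 𝔽₃
0# ⊗ b = 0#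
1# ⊗ b = b
2# ⊗ b = ⊖ b

_⊖_ : 𝔽₃ → 𝔽₃ → 𝔽₃
a ⊖ b = a ⊕ ⊖ b

_≟_ : (a b : 𝔽₃) → Dec (a ≡ b)
0# ≟ 0# = yes refl
0# ≟ 1# = no λ ()
0# ≟ 2# = no λ ()
1# ≟ 0# = no λ ()
1# ≟ 1# = yes refl
1# ≟ 2# = no λ ()
2# ≟ 0# = no λ ()
2# ≟ 1# = no λ ()
2# ≟ 2# = yes refl

-- Statements built from equations over 𝔽₃ with →, ⊎ and ∀ are decided by
-- instance search and then proved by running the decision procedure.
instance
  dec-≡ : {a b : 𝔽₃} → Dec (a ≡ b)
  dec-≡ = _ ≟ _

  dec-⊥ : Dec ⊥
  dec-⊥ = no λ ()

  dec-→ : {A B : Set} → {{Dec A}} → {{Dec B}} → Dec (A → B)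
  dec-→ {{a?}} {{b?}} = a? →-dec b?

  dec-⊎ : {A B : Set} → {{Dec A}} → {{Dec B}} → Dec (A ⊎ B)
  dec-⊎ {{a?}} {{b?}} = a? ⊎-dec b?

  dec-∀ : {P : 𝔽₃ → Set} → {{∀ {a} → Dec (P a)}} → Dec (∀ a → P a)
  dec-∀ {{p?}} with p? {0#} | p? {1#} | p? {2#}
  ... | yes p₀ | yes p₁ | yes p₂ = yes λ where 0# → p₀; 1# → p₁; 2# → p₂
  ... | no ¬p₀ | _      | _      = no λ p → ¬p₀ (p 0#)
  ... | _      | no ¬p₁ | _      = no λ p → ¬p₁ (p 1#)
  ... | _      | _      | no ¬p₂ = no λ p → ¬p₂ (p 2#)

decide : {A : Set} {{a? : Dec A}} {_ : True a?} → A
decide {{a?}} {t} = toWitness {a? = a?} t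

⊕-assoc : ∀ a b c → (a ⊕ b) ⊕ c ≡ a ⊕ (b ⊕ c)
⊕-assoc = decide

⊕-comm : ∀ a b → a ⊕ b ≡ b ⊕ a
⊕-comm = decide

⊕-identityʳ : ∀ a → a ⊕ 0# ≡ a
⊕-identityʳ = decide

⊗-distribʳ-⊕ : ∀ a b c → (a ⊕ b) ⊗ c ≡ a ⊗ c ⊕ b ⊗ c
⊗-distribʳ-⊕ = decide

⊗-interchange : ∀ a b c d → (a ⊗ b) ⊗ (c ⊗ d) ≡ (a ⊗ c) ⊗ (b ⊗ d)
⊗-interchange = decide

⊖-distrib-⊕ : ∀ a b → ⊖ (a ⊕ b) ≡ ⊖ a ⊕ ⊖ b
⊖-distrib-⊕ = decide

⊖-distribˡ-⊗ : ∀ a b → ⊖ (a ⊗ b) ≡ ⊖ a ⊗ b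
⊖-distribˡ-⊗ = decide

[1+a]⊖[1+b]≡a⊖b : ∀ a b → (1# ⊕ a) ⊖ (1# ⊕ b) ≡ a ⊖ b
[1+a]⊖[1+b]≡a⊖b = decide

⊖a≡0⇒a≡0 : ∀ a → ⊖ a ≡ 0# → a ≡ 0#
⊖a≡0⇒a≡0 = decide

a≢b⇒a⊖b≢0 : ∀ a b → a ≢ b → a ⊖ b ≢ 0#
a≢b⇒a⊖b≢0 = decide

⊗-nonzero : ∀ a b → a ≢ 0# → b ≢ 0# → a ⊗ b ≢ 0#
⊗-nonzero = decide

⊗-unit-involutive : ∀ a b → b ≢ 0# → (a ⊗ b) ⊗ b ≡ a
⊗-unit-involutive = decide

-- the nonzero squares are all 1, and 1 + 1 = 2 is not a square
nonzero-squares-sum-not-square : ∀ a b c → a ≢ 0# → b ≢ 0# → c ⊗ c ≢ a ⊗ a ⊕ b ⊗ b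
nonzero-squares-sum-not-square = decide

ρℕ : ℕ → 𝔽₃
ρℕ zero    = 0#
ρℕ (suc n) = 1# ⊕ ρℕ n

ρ : ℤ → 𝔽₃
ρ (+ n)    = ρℕ n
ρ -[1+ n ] = ⊖ ρℕ (suc n)

ρₛ : Sign → 𝔽₃
ρₛ Sign.+ = 1#
ρₛ Sign.- = 2#

ρℕ-homo-+ : ∀ m n → ρℕ (m ℕ.+ n) ≡ ρℕ m ⊕ ρℕ n
ρℕ-homo-+ zero    n = refl
ρℕ-homo-+ (suc m) n = trans (cong (1# ⊕_) (ρℕ-homo-+ m n)) (sym (⊕-assoc 1# (ρℕ m) (ρℕ n)))

ρℕ-homo-* : ∀ m n → ρℕ (m ℕ.* n) ≡ ρℕ m ⊗ ρℕ n
ρℕ-homo-* zero    n = refl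
ρℕ-homo-* (suc m) n = begin
  ρℕ (n ℕ.+ m ℕ.* n)     ≡⟨ ρℕ-homo-+ n (m ℕ.* n) ⟩
  ρℕ n ⊕ ρℕ (m ℕ.* n)    ≡⟨ cong (ρℕ n ⊕_) (ρℕ-homo-* m n) ⟩
  ρℕ n ⊕ ρℕ m ⊗ ρℕ n     ≡⟨ ⊗-distribʳ-⊕ 1# (ρℕ m) (ρℕ n) ⟨
  (1# ⊕ ρℕ m) ⊗ ρℕ n     ∎

ρ-◃ : ∀ s n → ρ (s ℤ.◃ n) ≡ ρₛ s ⊗ ρℕ n
ρ-◃ Sign.+ zero    = refl
ρ-◃ Sign.- zero    = refl
ρ-◃ Sign.+ (suc n) = refl
ρ-◃ Sign.- (suc n) = refl

ρ≡ρₛ[sign]⊗ρℕ∣∣ : ∀ i → ρ i ≡ ρₛ (sign i) ⊗ ρℕ ∣ i ∣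
ρ≡ρₛ[sign]⊗ρℕ∣∣ (+ zero)  = refl
ρ≡ρₛ[sign]⊗ρℕ∣∣ (+ suc n) = refl
ρ≡ρₛ[sign]⊗ρℕ∣∣ -[1+ n ]  = refl

ρₛ-homo-* : ∀ s t → ρₛ (s Sign.* t) ≡ ρₛ s ⊗ ρₛ t
ρₛ-homo-* Sign.+ Sign.+ = refl
ρₛ-homo-* Sign.+ Sign.- = refl
ρₛ-homo-* Sign.- Sign.+ = refl
ρₛ-homo-* Sign.- Sign.- = refl

ρ-homo-* : ∀ i j → ρ (i ℤ.* j) ≡ ρ i ⊗ ρ j
ρ-homo-* i j = begin
  ρ (sign i Sign.* sign j ℤ.◃ ∣ i ∣ ℕ.* ∣ j ∣)
    ≡⟨ ρ-◃ (sign i Sign.* sign j) (∣ i ∣ ℕ.* ∣ j ∣) ⟩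
  ρₛ (sign i Sign.* sign j) ⊗ ρℕ (∣ i ∣ ℕ.* ∣ j ∣)
    ≡⟨ cong₂ _⊗_ (ρₛ-homo-* (sign i) (sign j)) (ρℕ-homo-* ∣ i ∣ ∣ j ∣) ⟩
  (ρₛ (sign i) ⊗ ρₛ (sign j)) ⊗ (ρℕ ∣ i ∣ ⊗ ρℕ ∣ j ∣)
    ≡⟨ ⊗-interchange (ρₛ (sign i)) (ρₛ (sign j)) (ρℕ ∣ i ∣) (ρℕ ∣ j ∣) ⟩
  (ρₛ (sign i) ⊗ ρℕ ∣ i ∣) ⊗ (ρₛ (sign j) ⊗ ρℕ ∣ j ∣)
    ≡⟨ cong₂ _⊗_ (ρ≡ρₛ[sign]⊗ρℕ∣∣ i) (ρ≡ρₛ[sign]⊗ρℕ∣∣ j) ⟨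
  ρ i ⊗ ρ j
    ∎

ρ-homo‿- : ∀ i → ρ (ℤ.- i) ≡ ⊖ ρ i
ρ-homo‿- i = trans (cong ρ (sym (ℤP.-1*i≡-i i))) (ρ-homo-* -1ℤ i)

ρ-homo-⊖ : ∀ m n → ρ (m ℤ.⊖ n) ≡ ρℕ m ⊖ ρℕ n
ρ-homo-⊖ m       zero    = sym (⊕-identityʳ (ρℕ m))
ρ-homo-⊖ zero    (suc n) = refl
ρ-homo-⊖ (suc m) (suc n) = begin
  ρ (suc m ℤ.⊖ suc n)            ≡⟨ cong ρ (ℤP.[1+m]⊖[1+n]≡m⊖n m n) ⟩
  ρ (m ℤ.⊖ n)                    ≡⟨ ρ-homo-⊖ m n ⟩
  ρℕ m ⊖ ρℕ n                    ≡⟨ [1+a]⊖[1+b]≡a⊖b (ρℕ m) (ρℕ n) ⟨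
  ρℕ (suc m) ⊖ ρℕ (suc n)        ∎

ρ-homo-+ : ∀ i j → ρ (i ℤ.+ j) ≡ ρ i ⊕ ρ j
ρ-homo-+ (+ m)    (+ n)    = ρℕ-homo-+ m n
ρ-homo-+ (+ m)    -[1+ n ] = ρ-homo-⊖ m (suc n)
ρ-homo-+ -[1+ m ] (+ n)    = trans (ρ-homo-⊖ n (suc m)) (⊕-comm (ρℕ n) (⊖ ρℕ (suc m)))
ρ-homo-+ -[1+ m ] -[1+ n ] = begin
  ⊖ ρℕ (suc (suc (m ℕ.+ n)))     ≡⟨ cong (⊖_ ∘ ρℕ ∘ suc) (ℕP.+-suc m n) ⟨
  ⊖ ρℕ (suc m ℕ.+ suc n)         ≡⟨ cong ⊖_ (ρℕ-homo-+ (suc m) (suc n)) ⟩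
  ⊖ (ρℕ (suc m) ⊕ ρℕ (suc n))    ≡⟨ ⊖-distrib-⊕ (ρℕ (suc m)) (ρℕ (suc n)) ⟩
  ⊖ ρℕ (suc m) ⊕ ⊖ ρℕ (suc n)    ∎

ρℕ≡0⇒3∣ : ∀ n → ρℕ n ≡ 0# → 3 ∣ n
ρℕ≡0⇒3∣ zero                _   = divides 0 refl
ρℕ≡0⇒3∣ (suc zero)          ()
ρℕ≡0⇒3∣ (suc (suc zero))    ()
ρℕ≡0⇒3∣ (suc (suc (suc n))) ρ≡0 =
  ∣m∣n⇒∣m+n ∣-refl (ρℕ≡0⇒3∣ n (trans (sym (ρℕ-homo-+ 3 n)) ρ≡0))

ρ≡0⇒3∣ : ∀ i → ρ i ≡ 0# → 3 ∣ ∣ i ∣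
ρ≡0⇒3∣ (+ n)    = ρℕ≡0⇒3∣ n
ρ≡0⇒3∣ -[1+ n ] = ρℕ≡0⇒3∣ (suc n) ∘ ⊖a≡0⇒a≡0 (ρℕ (suc n))

ι≃ : ∀ i → toℚᵘ (ι i) ℚᵘ.≃ ℚᵘ.mkℚᵘ i 0
ι≃ i = toℚᵘ-fromℚᵘ (ℚᵘ.mkℚᵘ i 0)

ι-homo-+ : ∀ i j → ι (i ℤ.+ j) ≡ ι i + ι j
ι-homo-+ i j = toℚᵘ-injective (ℚᵘP.≃-trans (ι≃ (i ℤ.+ j)) (ℚᵘP.≃-sym
  (ℚᵘP.≃-trans (toℚᵘ-homo-+ (ι i) (ι j)) (ℚᵘP.≃-trans (ℚᵘP.+-cong (ι≃ i) (ι≃ j))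
    (ℚᵘ.*≡* (cong (ℤ._* + 1) (cong₂ ℤ._+_ (ℤP.*-identityʳ i) (ℤP.*-identityʳ j))))))))

ι-homo-* : ∀ i j → ι (i ℤ.* j) ≡ ι i * ι j
ι-homo-* i j = toℚᵘ-injective (ℚᵘP.≃-trans (ι≃ (i ℤ.* j)) (ℚᵘP.≃-sym
  (ℚᵘP.≃-trans (toℚᵘ-homo-* (ι i) (ι j)) (ℚᵘP.≃-trans (ℚᵘP.*-cong (ι≃ i) (ι≃ j))
    (ℚᵘ.*≡* refl)))))

ι-homo‿- : ∀ i → ι (ℤ.- i) ≡ - ι i
ι-homo‿- i = toℚᵘ-injective (ℚᵘP.≃-trans (ι≃ (ℤ.- i)) (ℚᵘP.≃-sym
  (ℚᵘP.≃-trans (toℚᵘ-homo‿- (ι i)) (ℚᵘP.-‿cong (ι≃ i)))))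

ι-injective : ∀ {i j} → ι i ≡ ι j → i ≡ j
ι-injective {i} {j} ιi≡ιj with ℚᵘP.≃-trans (ℚᵘP.≃-sym (ι≃ i)) (ℚᵘP.≃-trans (toℚᵘ-cong ιi≡ιj) (ι≃ j))
... | ℚᵘ.*≡* eq = trans (sym (ℤP.*-identityʳ i)) (trans eq (ℤP.*-identityʳ j))

ι-pos-* : ∀ m n → ι (+ (m ℕ.* n)) ≡ ι (+ m) * ι (+ n)
ι-pos-* m n = trans (cong ι (ℤP.pos-* m n)) (ι-homo-* (+ m) (+ n))

p*↧p≡↥p : ∀ p → p * ι (+ ↧ₙ p) ≡ ι (↥ p)
p*↧p≡↥p p@(mkℚ n d-1 _) = toℚᵘ-injective (ℚᵘP.≃-trans (toℚᵘ-homo-* p (ι (+ suc d-1)))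
  (ℚᵘP.≃-trans (ℚᵘP.*-cong (ℚᵘP.≃-refl {ℚᵘ.mkℚᵘ n d-1}) (ι≃ (+ suc d-1)))
    (ℚᵘP.≃-trans (ℚᵘ.*≡* (trans (ℤP.*-identityʳ _) (cong (λ k → n ℤ.* + suc k) (sym (ℕP.*-identityʳ d-1)))))
      (ℚᵘP.≃-sym (ι≃ n)))))

-- q = num / den with 3 ∤ den and num ≡ c · den (mod 3): q is 3-integral with residue c
record _≡₃_ (q : ℚ) (c : 𝔽₃) : Set where
  constructor residue
  field
    num        : ℤ
    den        : ℕ
    den≢0      : ρℕ den ≢ 0#
    q*den≡num  : q * ι (+ den) ≡ ι num
    num≡c*den  : ρ num ≡ c ⊗ ρℕ den

infix 4 _≡₃_

ρℕ-*-nonzero : ∀ s t → ρℕ s ≢ 0# → ρℕ t ≢ 0# → ρℕ (s ℕ.* t) ≢ 0#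
ρℕ-*-nonzero s t s≢0 t≢0 = ⊗-nonzero (ρℕ s) (ρℕ t) s≢0 t≢0 ∘ trans (sym (ρℕ-homo-* s t))

≡₃-+ : ∀ {p q c e} → p ≡₃ c → q ≡₃ e → p + q ≡₃ c ⊕ e
≡₃-+ {p} {q} {c} {e} (residue m s s≢0 ps≡m m≡cs) (residue n t t≢0 qt≡n n≡et) =
  residue (m ℤ.* + t ℤ.+ n ℤ.* + s) (s ℕ.* t) (ρℕ-*-nonzero s t s≢0 t≢0) scaled reduced
  where
  scaled : (p + q) * ι (+ (s ℕ.* t)) ≡ ι (m ℤ.* + t ℤ.+ n ℤ.* + s)
  scaled = begin
    (p + q) * ι (+ (s ℕ.* t))
      ≡⟨ cong ((p + q) *_) (ι-pos-* s t) ⟩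
    (p + q) * (ι (+ s) * ι (+ t))
      ≡⟨ solve 4 (λ p q S T → (p :+ q) :* (S :* T) := (p :* S) :* T :+ (q :* T) :* S)
               refl p q (ι (+ s)) (ι (+ t)) ⟩
    (p * ι (+ s)) * ι (+ t) + (q * ι (+ t)) * ι (+ s)
      ≡⟨ cong₂ (λ u v → u * ι (+ t) + v * ι (+ s)) ps≡m qt≡n ⟩
    ι m * ι (+ t) + ι n * ι (+ s)
      ≡⟨ cong₂ _+_ (ι-homo-* m (+ t)) (ι-homo-* n (+ s)) ⟨
    ι (m ℤ.* + t) + ι (n ℤ.* + s)
      ≡⟨ ι-homo-+ (m ℤ.* + t) (n ℤ.* + s) ⟨
    ι (m ℤ.* + t ℤ.+ n ℤ.* + s)
      ∎
  fraction-sum : ∀ c e s t → c ⊗ s ⊗ t ⊕ e ⊗ t ⊗ s ≡ (c ⊕ e) ⊗ (s ⊗ t)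
  fraction-sum = decide
  reduced : ρ (m ℤ.* + t ℤ.+ n ℤ.* + s) ≡ (c ⊕ e) ⊗ ρℕ (s ℕ.* t)
  reduced = begin
    ρ (m ℤ.* + t ℤ.+ n ℤ.* + s)     ≡⟨ ρ-homo-+ (m ℤ.* + t) (n ℤ.* + s) ⟩
    ρ (m ℤ.* + t) ⊕ ρ (n ℤ.* + s)   ≡⟨ cong₂ _⊕_ (ρ-homo-* m (+ t)) (ρ-homo-* n (+ s)) ⟩
    ρ m ⊗ ρℕ t ⊕ ρ n ⊗ ρℕ s         ≡⟨ cong₂ (λ u v → u ⊗ ρℕ t ⊕ v ⊗ ρℕ s) m≡cs n≡et ⟩
    c ⊗ ρℕ s ⊗ ρℕ t ⊕ e ⊗ ρℕ t ⊗ ρℕ s ≡⟨ fraction-sum c e (ρℕ s) (ρℕ t) ⟩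
    (c ⊕ e) ⊗ (ρℕ s ⊗ ρℕ t)         ≡⟨ cong ((c ⊕ e) ⊗_) (ρℕ-homo-* s t) ⟨
    (c ⊕ e) ⊗ ρℕ (s ℕ.* t)          ∎

≡₃-* : ∀ {p q c e} → p ≡₃ c → q ≡₃ e → p * q ≡₃ c ⊗ e
≡₃-* {p} {q} {c} {e} (residue m s s≢0 ps≡m m≡cs) (residue n t t≢0 qt≡n n≡et) =
  residue (m ℤ.* n) (s ℕ.* t) (ρℕ-*-nonzero s t s≢0 t≢0) scaled reduced
  where
  scaled : (p * q) * ι (+ (s ℕ.* t)) ≡ ι (m ℤ.* n)
  scaled = begin
    (p * q) * ι (+ (s ℕ.* t))       ≡⟨ cong ((p * q) *_) (ι-pos-* s t) ⟩
    (p * q) * (ι (+ s) * ι (+ t))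
      ≡⟨ solve 4 (λ p q S T → (p :* q) :* (S :* T) := (p :* S) :* (q :* T))
               refl p q (ι (+ s)) (ι (+ t)) ⟩
    (p * ι (+ s)) * (q * ι (+ t))   ≡⟨ cong₂ _*_ ps≡m qt≡n ⟩
    ι m * ι n                       ≡⟨ ι-homo-* m n ⟨
    ι (m ℤ.* n)                     ∎
  reduced : ρ (m ℤ.* n) ≡ (c ⊗ e) ⊗ ρℕ (s ℕ.* t)
  reduced = begin
    ρ (m ℤ.* n)                ≡⟨ ρ-homo-* m n ⟩
    ρ m ⊗ ρ n                  ≡⟨ cong₂ _⊗_ m≡cs n≡et ⟩
    (c ⊗ ρℕ s) ⊗ (e ⊗ ρℕ t)    ≡⟨ ⊗-interchange c (ρℕ s) e (ρℕ t) ⟩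
    (c ⊗ e) ⊗ (ρℕ s ⊗ ρℕ t)    ≡⟨ cong ((c ⊗ e) ⊗_) (ρℕ-homo-* s t) ⟨
    (c ⊗ e) ⊗ ρℕ (s ℕ.* t)     ∎

≡₃-‿ : ∀ {p c} → p ≡₃ c → - p ≡₃ ⊖ c
≡₃-‿ {p} {c} (residue m s s≢0 ps≡m m≡cs) = residue (ℤ.- m) s s≢0 scaled reduced
  where
  scaled : (- p) * ι (+ s) ≡ ι (ℤ.- m)
  scaled = begin
    (- p) * ι (+ s)   ≡⟨ solve 2 (λ p S → (:- p) :* S := :- (p :* S)) refl p (ι (+ s)) ⟩
    - (p * ι (+ s))   ≡⟨ cong -_ ps≡m ⟩
    - ι m             ≡⟨ ι-homo‿- m ⟨
    ι (ℤ.- m)         ∎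
  reduced : ρ (ℤ.- m) ≡ ⊖ c ⊗ ρℕ s
  reduced = trans (ρ-homo‿- m) (trans (cong ⊖_ m≡cs) (⊖-distribˡ-⊗ c (ρℕ s)))

≡₃-- : ∀ {p q c e} → p ≡₃ c → q ≡₃ e → p - q ≡₃ c ⊖ e
≡₃-- p≡c q≡e = ≡₃-+ p≡c (≡₃-‿ q≡e)

-- every unit of 𝔽₃ is its own inverse, so m / s reduces to ρ m ⊗ ρ s
≡₃-fraction : ∀ {t} m s → ρℕ s ≢ 0# → t * ι (+ s) ≡ ι m → t ≡₃ ρ m ⊗ ρℕ s
≡₃-fraction m s s≢0 ts≡m =
  residue m s s≢0 ts≡m (sym (⊗-unit-involutive (ρ m) (ρℕ s) s≢0))

-- Writing d = N / D in lowest terms, d² ≡₃ c gives N² s = m D² with 3 ∤ s;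
-- if 3 ∣ D then 3 ∣ N, contradicting coprimality, so d ≡₃ N / D.
≡₃-sqrt : ∀ {d c} → d * d ≡₃ c → Σ 𝔽₃ λ e → d ≡₃ e × e ⊗ e ≡ c
≡₃-sqrt {d@(mkℚ N D-1 N⊥D)} {c} (residue m s s≢0 dds≡m m≡cs) =
  ρ N ⊗ ρℕ D , ≡₃-fraction N D D≢0 dD≡N , root (ρ N) (ρℕ s) c (ρℕ D) s≢0 D≢0 reduced
  where
  D : ℕ
  D = suc D-1
  dD≡N : d * ι (+ D) ≡ ι N
  dD≡N = p*↧p≡↥p d
  cleared : N ℤ.* N ℤ.* + s ≡ m ℤ.* (+ D ℤ.* + D)
  cleared = ι-injective (begin
    ι (N ℤ.* N ℤ.* + s)                     ≡⟨ ι-homo-* (N ℤ.* N) (+ s) ⟩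
    ι (N ℤ.* N) * ι (+ s)                    ≡⟨ cong (_* ι (+ s)) (ι-homo-* N N) ⟩
    ι N * ι N * ι (+ s)                      ≡⟨ cong (λ u → u * u * ι (+ s)) dD≡N ⟨
    (d * ι (+ D)) * (d * ι (+ D)) * ι (+ s)
      ≡⟨ solve 3 (λ d D s → (d :* D) :* (d :* D) :* s := ((d :* d) :* s) :* (D :* D))
               refl d (ι (+ D)) (ι (+ s)) ⟩
    ((d * d) * ι (+ s)) * (ι (+ D) * ι (+ D)) ≡⟨ cong₂ _*_ dds≡m (sym (ι-homo-* (+ D) (+ D))) ⟩
    ι m * ι (+ D ℤ.* + D)                    ≡⟨ ι-homo-* m (+ D ℤ.* + D) ⟨
    ι (m ℤ.* (+ D ℤ.* + D))                  ∎)
  reduced : ρ N ⊗ ρ N ⊗ ρℕ s ≡ (c ⊗ ρℕ s) ⊗ (ρℕ D ⊗ ρℕ D)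
  reduced = begin
    ρ N ⊗ ρ N ⊗ ρℕ s               ≡⟨ cong (_⊗ ρℕ s) (ρ-homo-* N N) ⟨
    ρ (N ℤ.* N) ⊗ ρℕ s             ≡⟨ ρ-homo-* (N ℤ.* N) (+ s) ⟨
    ρ (N ℤ.* N ℤ.* + s)            ≡⟨ cong ρ cleared ⟩
    ρ (m ℤ.* (+ D ℤ.* + D))        ≡⟨ ρ-homo-* m (+ D ℤ.* + D) ⟩
    ρ m ⊗ ρ (+ D ℤ.* + D)          ≡⟨ cong₂ _⊗_ m≡cs (ρ-homo-* (+ D) (+ D)) ⟩
    (c ⊗ ρℕ s) ⊗ (ρℕ D ⊗ ρℕ D)     ∎
  numerator-divisible : ∀ n s m d → s ≢ 0# → n ⊗ n ⊗ s ≡ m ⊗ (d ⊗ d) → d ≡ 0# → n ≡ 0#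
  numerator-divisible = decide
  root : ∀ n s c d → s ≢ 0# → d ≢ 0# → n ⊗ n ⊗ s ≡ (c ⊗ s) ⊗ (d ⊗ d) → (n ⊗ d) ⊗ (n ⊗ d) ≡ c
  root = decide
  D≢0 : ρℕ D ≢ 0#
  D≢0 D≡0 = Irrelevant.⊥-elim (3≢1 (N⊥D (ρ≡0⇒3∣ N N≡0 , ρℕ≡0⇒3∣ D D≡0)))
    where
    N≡0 : ρ N ≡ 0#
    N≡0 = numerator-divisible (ρ N) (ρℕ s) (c ⊗ ρℕ s) (ρℕ D) s≢0 reduced D≡0
    3≢1 : 3 ≢ 1
    3≢1 ()

DistSquare : ℚ → ℚ → ℚ → ℚ → ℚ
DistSquare x₁ y₁ x₂ y₂ = (x₁ - x₂) * (x₁ - x₂) + (y₁ - y₂) * (y₁ - y₂)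

IsSquare : ℚ → Set
IsSquare q = Σ ℚ λ d → d * d ≡ q

IsSquare-*-square : ∀ {q} t → IsSquare q → IsSquare (q * (t * t))
IsSquare-*-square {q} t (d , d²≡q) = d * t , (begin
  (d * t) * (d * t)   ≡⟨ solve 2 (λ d t → (d :* t) :* (d :* t) := (d :* d) :* (t :* t)) refl d t ⟩
  (d * d) * (t * t)   ≡⟨ cong (_* (t * t)) d²≡q ⟩
  q * (t * t)         ∎)

DistSquare-* : ∀ x₁ y₁ x₂ y₂ t →
  DistSquare x₁ y₁ x₂ y₂ * (t * t) ≡ DistSquare (x₁ * t) (y₁ * t) (x₂ * t) (y₂ * t)
DistSquare-* = solve 5 (λ x₁ y₁ x₂ y₂ t →
  ((x₁ :- x₂) :* (x₁ :- x₂) :+ (y₁ :- y₂) :* (y₁ :- y₂)) :* (t :* t) :=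
  (x₁ :* t :- x₂ :* t) :* (x₁ :* t :- x₂ :* t) :+ (y₁ :* t :- y₂ :* t) :* (y₁ :* t :- y₂ :* t)) refl

residues-differ⇒¬IsSquare : ∀ {x₁ y₁ x₂ y₂ a₁ b₁ a₂ b₂} →
  x₁ ≡₃ a₁ → y₁ ≡₃ b₁ → x₂ ≡₃ a₂ → y₂ ≡₃ b₂ → a₁ ≢ a₂ → b₁ ≢ b₂ →
  ¬ IsSquare (DistSquare x₁ y₁ x₂ y₂)
residues-differ⇒¬IsSquare {x₁} {y₁} {x₂} {y₂} {a₁} {b₁} {a₂} {b₂} x₁≡a₁ y₁≡b₁ x₂≡a₂ y₂≡b₂ a₁≢a₂ b₁≢b₂ (d , d²≡) =
  let e , _ , e²≡ = ≡₃-sqrt {d} (subst (_≡₃ _) (sym d²≡) (≡₃-+ (≡₃-* Δx Δx) (≡₃-* Δy Δy)))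
  in nonzero-squares-sum-not-square (a₁ ⊖ a₂) (b₁ ⊖ b₂) e
       (a≢b⇒a⊖b≢0 a₁ a₂ a₁≢a₂) (a≢b⇒a⊖b≢0 b₁ b₂ b₁≢b₂) e²≡
  where
  Δx : x₁ - x₂ ≡₃ a₁ ⊖ a₂
  Δx = ≡₃-- x₁≡a₁ x₂≡a₂
  Δy : y₁ - y₂ ≡₃ b₁ ⊖ b₂
  Δy = ≡₃-- y₁≡b₁ y₂≡b₂

residues-differ⇒¬RationalDist : ∀ {x₁ y₁ x₂ y₂ a₁ b₁ a₂ b₂} →
  x₁ ≡₃ a₁ → y₁ ≡₃ b₁ → x₂ ≡₃ a₂ → y₂ ≡₃ b₂ → a₁ ≢ a₂ → b₁ ≢ b₂ →
  ¬ RationalDist x₁ y₁ x₂ y₂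
residues-differ⇒¬RationalDist x₁≡a₁ y₁≡b₁ x₂≡a₂ y₂≡b₂ a₁≢a₂ b₁≢b₂ (d , _ , d²≡) =
  residues-differ⇒¬IsSquare x₁≡a₁ y₁≡b₁ x₂≡a₂ y₂≡b₂ a₁≢a₂ b₁≢b₂ (d , d²≡)

0≡₃0 : 0ℚ ≡₃ 0#
0≡₃0 = residue (+ 0) 1 (λ ()) refl refl

½≡₃2 : ½ ≡₃ 2#
½≡₃2 = residue (+ 1) 2 (λ ()) refl refl

-½≡₃1 : -½ ≡₃ 1#
-½≡₃1 = residue -[1+ 0 ] 2 (λ ()) refl refl

3^[1+n]≡₃0 : ∀ n → ι (+ 3 ^ suc n) ≡₃ 0#
3^[1+n]≡₃0 n = residue (+ 3 ^ suc n) 1 (λ ()) (*-identityʳ _) (ρℕ-homo-* 3 (3 ^ n))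

record Unit₃ (t : ℚ) : Set where
  constructor unit
  field
    {res}   : 𝔽₃
    res≢0   : res ≢ 0#
    reduces : t ≡₃ res

fraction-unit : ∀ {t} m s → ρ m ≢ 0# → ρℕ s ≢ 0# → t * ι (+ s) ≡ ι m → Unit₃ t
fraction-unit m s m≢0 s≢0 ts≡m =
  unit (⊗-nonzero (ρ m) (ρℕ s) m≢0 s≢0) (≡₃-fraction m s s≢0 ts≡m)

3∤⇒ρℕ≢0 : ∀ {n} → ¬ 3 ∣ n → ρℕ n ≢ 0#
3∤⇒ρℕ≢0 {n} 3∤n = 3∤n ∘ ρℕ≡0⇒3∣ n

3∤⇒ρ≢0 : ∀ i → ¬ 3 ∣ ∣ i ∣ → ρ i ≢ 0#
3∤⇒ρ≢0 i 3∤i = 3∤i ∘ ρ≡0⇒3∣ i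

HasVal-0⇒Unit₃ : ∀ t → HasVal 3 t (+ 0) → Unit₃ t
HasVal-0⇒Unit₃ t (r , s , 3∤r , 3∤s , ts≡r) =
  fraction-unit r s (3∤⇒ρ≢0 r 3∤r) (3∤⇒ρℕ≢0 3∤s) (trans ts≡r (cong ι (ℤP.*-identityˡ r)))

HasVal-suc⇒≡₃0 : ∀ t n → HasVal 3 t (+ suc n) → t ≡₃ 0#
HasVal-suc⇒≡₃0 t n (r , s , _ , 3∤s , ts≡3ⁿr) =
  residue (+ 3 ^ suc n ℤ.* r) s (3∤⇒ρℕ≢0 3∤s) ts≡3ⁿr
    (trans (ρ-homo-* (+ 3 ^ suc n) r) (cong (_⊗ ρ r) (ρℕ-homo-* 3 (3 ^ n))))

HasVal-neg⇒Unit₃ : ∀ t n → HasVal 3 t -[1+ n ] → Unit₃ (t * ι (+ 3 ^ suc n))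
HasVal-neg⇒Unit₃ t n (r , s , 3∤r , 3∤s , t3ⁿs≡r) =
  fraction-unit r s (3∤⇒ρ≢0 r 3∤r) (3∤⇒ρℕ≢0 3∤s) (begin
    (t * T) * ι (+ s)         ≡⟨ solve 3 (λ t T s → (t :* T) :* s := t :* (s :* T)) refl t T (ι (+ s)) ⟩
    t * (ι (+ s) * T)         ≡⟨ cong (t *_) (ι-pos-* s (3 ^ suc n)) ⟨
    t * ι (+ (s ℕ.* 3 ^ suc n)) ≡⟨ t3ⁿs≡r ⟩
    ι r                       ∎)
  where
  T = ι (+ 3 ^ suc n)

divisible-case : ∀ a x z → Unit₃ a → x ≡₃ 0# → z ≡₃ 0# → ¬ RationalDist x (z * ½) a ½
divisible-case a x z (unit α≢0 a≡α) x≡0 z≡0 =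
  residues-differ⇒¬RationalDist x≡0 (≡₃-* z≡0 ½≡₃2) a≡α ½≡₃2 (α≢0 ∘ sym) (λ ())

-- z/2 cannot be congruent to both 1/2 and -1/2
unit-case : ∀ x z {b} → Unit₃ x → z ≡₃ b →
  RationalDist x (z * ½) 0ℚ ½ → RationalDist x (z * ½) 0ℚ -½ → ⊥
unit-case x z {b} (unit A≢0 x≡A) z≡b d₁ d₂ =
  [ (λ ≢2 → apart ½≡₃2 ≢2 d₁) , (λ ≢1 → apart -½≡₃1 ≢1 d₂) ]′ (differs (b ⊗ 2#))
  where
  apart : ∀ {y c} → y ≡₃ c → b ⊗ 2# ≢ c → ¬ RationalDist x (z * ½) 0ℚ y
  apart y≡c = residues-differ⇒¬RationalDist x≡A (≡₃-* z≡b ½≡₃2) 0≡₃0 y≡c A≢0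
  differs : ∀ c → c ≢ 2# ⊎ c ≢ 1#
  differs = decide

-- scaling by t = 3^(-v) turns x and z into units and moves (0, 1/2) to a point ≡ (0, 0)
negative-case : ∀ {t} x z → t ≡₃ 0# → Unit₃ (x * t) → Unit₃ (z * t) → ¬ RationalDist x (z * ½) 0ℚ ½
negative-case {t} x z t≡0 (unit A≢0 xt≡A) (unit {B} B≢0 zt≡B) (d , _ , d²≡) =
  residues-differ⇒¬IsSquare xt≡A z½t≡2B (≡₃-* 0≡₃0 t≡0) (≡₃-* ½≡₃2 t≡0)
    A≢0 (⊗-nonzero B 2# B≢0 λ ()) scaled
  where
  z½t≡2B : (z * ½) * t ≡₃ B ⊗ 2#
  z½t≡2B = subst (_≡₃ B ⊗ 2#) (solve 3 (λ z h t → (z :* t) :* h := (z :* h) :* t) refl z ½ t)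
             (≡₃-* zt≡B ½≡₃2)
  scaled : IsSquare (DistSquare (x * t) ((z * ½) * t) (0ℚ * t) (½ * t))
  scaled = subst IsSquare (DistSquare-* x (z * ½) 0ℚ ½ t) (IsSquare-*-square t (d , d²≡))

proposition2p2 : (a x z : ℚ) → HasVal 3 a (+ 0) →
    RationalDist x (z * ½) 0ℚ ½ → RationalDist x (z * ½) 0ℚ -½ →
    RationalDist x (z * ½) a ½ → RationalDist x (z * ½) a -½ →
    ¬ SameVal 3 x z
proposition2p2 a x z a-val _ _ d₃ _ (inj₁ (refl , refl)) =
  divisible-case a 0ℚ 0ℚ (HasVal-0⇒Unit₃ a a-val) 0≡₃0 0≡₃0 d₃
proposition2p2 a x z a-val _ _ d₃ _ (inj₂ (+ suc n , x-val , z-val)) =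
  divisible-case a x z (HasVal-0⇒Unit₃ a a-val)
    (HasVal-suc⇒≡₃0 x n x-val) (HasVal-suc⇒≡₃0 z n z-val) d₃
proposition2p2 a x z _ d₁ d₂ _ _ (inj₂ (+ 0 , x-val , z-val)) =
  unit-case x z (HasVal-0⇒Unit₃ x x-val) (Unit₃.reduces (HasVal-0⇒Unit₃ z z-val)) d₁ d₂
proposition2p2 a x z _ d₁ _ _ _ (inj₂ (-[1+ n ] , x-val , z-val)) =
  negative-case x z (3^[1+n]≡₃0 n) (HasVal-neg⇒Unit₃ x n x-val) (HasVal-neg⇒Unit₃ z n z-val) d₁
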